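{- Let $A\subset\mathbb{F}_5^2$ be a sum-free set with $|A|\ge 5$. Then there is an invertible linear map $\phi:\mathbb{F}_5^2\to\mathbb{F}_5^2$ such that $\phi(A)$ contains $(1,0)$, $(1,1)$ and $(1,2)$.
   Context: A set $A$ is sum-free if there are no $a,b,c\in A$ with $a+b=c$. -}

module Defs where

open import Data.Nat using (ℕ)
open import Data.Fin using (Fin; toℕ; zero; suc)
open import Data.Nat.DivMod using (_mod_)
open import Data.Product using (_×_; _,_)
open import Data.List using (List)
open import Data.List.Membership.Propositional using (_∈_)
open import Relation.Binary.PropositionalEquality using (_≡_)
open import Relation.Nullary using (¬_)
import Data.Nat as ℕ

F5 : Set
F5 = Fin 5

infixl 6 _+₅_ _-₅_
infixl 7 _*₅_

_+₅_ : F5 → F5 → F5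
a +₅ b = (toℕ a ℕ.+ toℕ b) mod 5

_*₅_ : F5 → F5 → F5
a *₅ b = (toℕ a ℕ.* toℕ b) mod 5

_-₅_ : F5 → F5 → F5
a -₅ b = (toℕ a ℕ.+ (5 ℕ.∸ toℕ b)) mod 5

V : Set
V = F5 × F5

_⊕_ : V → V → V
(x₁ , y₁) ⊕ (x₂ , y₂) = (x₁ +₅ x₂ , y₁ +₅ y₂)

-- A finite set A ⊆ F_5^2 is given as a duplicate-free list (see Statement);
-- sum-free: no a, b, c ∈ A with a + b = c (a = b allowed).
SumFree : List V → Set
SumFree A = ∀ {a b c} → a ∈ A → b ∈ A → c ∈ A → ¬ (a ⊕ b ≡ c)

record Mat : Set where
  constructor mat
  field
    a b c d : F5

det : Mat → F5
det (mat a b c d) = (a *₅ d) -₅ (b *₅ c)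


apply : Mat → V → V
apply (mat a b c d) (x , y) = ((a *₅ x) +₅ (b *₅ y) , (c *₅ x) +₅ (d *₅ y))

Invertible : Mat → Set
Invertible M = Data.Product.∃ λ N → (∀ v → apply N (apply M v) ≡ v) × (∀ v → apply M (apply N v) ≡ v)
  where import Data.Product

InImage : Mat → List V → V → Set
InImage M A v = Data.Product.∃ λ u → u ∈ A × apply M u ≡ v
  where import Data.Product

one two : F5
one = suc zero
two = suc (suc zero)

-- It suffices to find x, x + y, x + 2y in A with x, y linearly independent:
-- the linear map sending x, y to (1,0), (0,1) is then the required φ.  Two
-- distinct dependent elements of a sum-free set are negatives of each other,
-- so of any three elements a, b, c of A one of the pairs (a, b), (a, c) is a
-- basis.  Once that basis is moved to (1,0), (0,1), the remaining three
-- elements of a five-element sum-free subset range over finitely many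
-- configurations, each of which contains such a progression.
module Submission where

open import Defs
open import Relation.Binary.PropositionalEquality
open import Algebra.Structures {A = F5} _≡_ using (IsCommutativeSemiring)
open import Algebra.Structures.Biased {A = F5} _≡_ using (isCommutativeSemiringˡ; isCommutativeMonoidˡ)
open import Data.Empty using (⊥-elim)
open import Data.Fin using (zero; suc; _≟_)
open import Data.Fin.Properties using (all?; any?)
open import Data.List using (List; []; _∷_; _++_; map; length)
open import Data.List.Membership.Propositional using (_∈_; find)
open import Data.List.Membership.Propositional.Properties using (∈-map⁻)
open import Data.List.Membership.DecPropositional using () renaming (_∈?_ to ∈?-with)
open import Data.List.Relation.Binary.Subset.Propositional using (_⊆_)
open import Data.List.Relation.Binary.Subset.Propositional.Properties using (xs⊆xs++ys)
open import Data.List.Relation.Unary.All as All using (All; _∷_)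
open import Data.List.Relation.Unary.All.Properties using (++⁻ˡ)
open import Data.List.Relation.Unary.AllPairs using ([]; _∷_)
open import Data.List.Relation.Unary.Any as Any using (here; there)
open import Data.List.Relation.Unary.Unique.Propositional using (Unique)
import Data.List.Relation.Unary.Unique.Propositional.Properties as Unique
open import Data.List.Relation.Unary.Unique.DecPropositional using (unique?)
open import Data.Maybe using (nothing)
open import Data.Nat using (_≤_; s≤s)
open import Data.Product using (Σ; ∃; _×_; _,_)
open import Data.Product.Properties using (≡-dec)
open import Data.Sum using (_⊎_; inj₁; inj₂)
open import Function using (_∘_)
open import Level using (0ℓ)
open import Relation.Binary using (DecidableEquality)
open import Relation.Binary.PropositionalEquality.Algebra using (isMagma)
open import Relation.Nullary using (Dec; ¬_; yes; no)
open import Relation.Nullary.Decidable using (map′; from-yes; _×-dec_; _→-dec_; ¬?)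
open import Relation.Unary using (Pred; Decidable)
open import Tactic.RingSolver using (solve-∀)
open import Tactic.RingSolver.Core.AlmostCommutativeRing using (AlmostCommutativeRing; fromCommutativeSemiring)

open ≡-Reasoning

_≟ᵥ_ : DecidableEquality V
_≟ᵥ_ = ≡-dec _≟_ _≟_

infix 4 _∈?_ _≟ᵥ_ _≟ₘ_

_∈?_ : ∀ v A → Dec (v ∈ A)
_∈?_ = ∈?-with _≟ᵥ_

allᵥ? : {P : Pred V 0ℓ} → Decidable P → Dec (∀ v → P v)
allᵥ? P? = map′ (λ h (x , y) → h x y) (λ h x y → h (x , y)) (all? λ x → all? λ y → P? (x , y))

anyᵥ? : {P : Pred V 0ℓ} → Decidable P → Dec (∃ P)
anyᵥ? P? = map′ (λ (x , y , p) → (x , y) , p) (λ ((x , y) , p) → x , y , p) (any? λ x → any? λ y → P? (x , y))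

+₅-*₅-isCommutativeSemiring : IsCommutativeSemiring _+₅_ _*₅_ zero one
+₅-*₅-isCommutativeSemiring = isCommutativeSemiringˡ record
  { +-isCommutativeMonoid = isCommutativeMonoidˡ record
    { isSemigroup = record
      { isMagma = isMagma _+₅_
      ; assoc   = from-yes (all? λ x → all? λ y → all? λ z → (x +₅ y) +₅ z ≟ x +₅ (y +₅ z))
      }
    ; identityˡ = from-yes (all? λ x → zero +₅ x ≟ x)
    ; comm      = from-yes (all? λ x → all? λ y → x +₅ y ≟ y +₅ x)
    }
  ; *-isCommutativeMonoid = isCommutativeMonoidˡ record
    { isSemigroup = record
      { isMagma = isMagma _*₅_
      ; assoc   = from-yes (all? λ x → all? λ y → all? λ z → (x *₅ y) *₅ z ≟ x *₅ (y *₅ z))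
      }
    ; identityˡ = from-yes (all? λ x → one *₅ x ≟ x)
    ; comm      = from-yes (all? λ x → all? λ y → x *₅ y ≟ y *₅ x)
    }
  ; distribʳ = from-yes (all? λ x → all? λ y → all? λ z → (y +₅ z) *₅ x ≟ y *₅ x +₅ z *₅ x)
  ; zeroˡ    = from-yes (all? λ x → zero *₅ x ≟ zero)
  }

F5-semiring : AlmostCommutativeRing 0ℓ 0ℓ
F5-semiring = fromCommutativeSemiring
  (record { isCommutativeSemiring = +₅-*₅-isCommutativeSemiring }) λ _ → nothing

apply-⊕ : ∀ M u v → apply M (u ⊕ v) ≡ apply M u ⊕ apply M v
apply-⊕ (mat a b c d) (x₁ , y₁) (x₂ , y₂) = cong₂ _,_ (row a b x₁ y₁ x₂ y₂) (row c d x₁ y₁ x₂ y₂)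
  where
  row : ∀ a b x₁ y₁ x₂ y₂ →
        a *₅ (x₁ +₅ x₂) +₅ b *₅ (y₁ +₅ y₂) ≡ (a *₅ x₁ +₅ b *₅ y₁) +₅ (a *₅ x₂ +₅ b *₅ y₂)
  row = solve-∀ F5-semiring

infixl 7 _·ₘ_

_·ₘ_ : Mat → Mat → Mat
mat a b c d ·ₘ mat e f g h = mat (a *₅ e +₅ b *₅ g) (a *₅ f +₅ b *₅ h) (c *₅ e +₅ d *₅ g) (c *₅ f +₅ d *₅ h)

1ₘ : Mat
1ₘ = mat one zero zero one

apply-·ₘ : ∀ M N v → apply (M ·ₘ N) v ≡ apply M (apply N v)
apply-·ₘ (mat a b c d) (mat e f g h) (x , y) = cong₂ _,_ (row a b e f g h x y) (row c d e f g h x y)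
  where
  row : ∀ a b e f g h x y →
        (a *₅ e +₅ b *₅ g) *₅ x +₅ (a *₅ f +₅ b *₅ h) *₅ y ≡ a *₅ (e *₅ x +₅ f *₅ y) +₅ b *₅ (g *₅ x +₅ h *₅ y)
  row = solve-∀ F5-semiring

apply-1ₘ : ∀ v → apply 1ₘ v ≡ v
apply-1ₘ = from-yes (allᵥ? λ v → apply 1ₘ v ≟ᵥ v)

_≟ₘ_ : DecidableEquality Mat
mat a b c d ≟ₘ mat a′ b′ c′ d′ =
  map′ (λ { (refl , refl , refl , refl) → refl }) (λ { refl → refl , refl , refl , refl })
       (a ≟ a′ ×-dec b ≟ b′ ×-dec c ≟ c′ ×-dec d ≟ d′)

apply-inverse : ∀ {M N} → M ·ₘ N ≡ 1ₘ → ∀ v → apply M (apply N v) ≡ v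
apply-inverse {M} {N} MN≡1 v = begin
  apply M (apply N v) ≡⟨ apply-·ₘ M N v ⟨
  apply (M ·ₘ N) v    ≡⟨ cong (λ P → apply P v) MN≡1 ⟩
  apply 1ₘ v          ≡⟨ apply-1ₘ v ⟩
  v                   ∎

inverse⇒invertible : ∀ {M N} → N ·ₘ M ≡ 1ₘ → M ·ₘ N ≡ 1ₘ → Invertible M
inverse⇒invertible {M} {N} NM≡1 MN≡1 = N , apply-inverse {N} {M} NM≡1 , apply-inverse {M} {N} MN≡1

invertible-·ₘ : ∀ {M N} → Invertible M → Invertible N → Invertible (M ·ₘ N)
invertible-·ₘ {M} {N} (M⁻¹ , M⁻¹M , MM⁻¹) (N⁻¹ , N⁻¹N , NN⁻¹) =
  N⁻¹ ·ₘ M⁻¹ , undo {M} {M⁻¹} {N} {N⁻¹} M⁻¹M N⁻¹N , undo {N⁻¹} {N} {M⁻¹} {M} NN⁻¹ MM⁻¹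
  where
  undo : ∀ {P P′ Q Q′} → (∀ v → apply P′ (apply P v) ≡ v) → (∀ v → apply Q′ (apply Q v) ≡ v) →
         ∀ v → apply (Q′ ·ₘ P′) (apply (P ·ₘ Q) v) ≡ v
  undo {P} {P′} {Q} {Q′} P′P Q′Q v = begin
    apply (Q′ ·ₘ P′) (apply (P ·ₘ Q) v)       ≡⟨ apply-·ₘ Q′ P′ _ ⟩
    apply Q′ (apply P′ (apply (P ·ₘ Q) v))    ≡⟨ cong (apply Q′ ∘ apply P′) (apply-·ₘ P Q v) ⟩
    apply Q′ (apply P′ (apply P (apply Q v))) ≡⟨ cong (apply Q′) (P′P _) ⟩
    apply Q′ (apply Q v)                      ≡⟨ Q′Q v ⟩
    v                                         ∎

invertible⇒injective : ∀ {M u v} → Invertible M → apply M u ≡ apply M v → u ≡ v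
invertible⇒injective {M} {u} {v} (M⁻¹ , M⁻¹M , _) Mu≡Mv = begin
  u                     ≡⟨ M⁻¹M u ⟨
  apply M⁻¹ (apply M u) ≡⟨ cong (apply M⁻¹) Mu≡Mv ⟩
  apply M⁻¹ (apply M v) ≡⟨ M⁻¹M v ⟩
  v                     ∎

e₁ e₂ : V
e₁ = (one , zero)
e₂ = (zero , one)

columns : V → V → Mat
columns (x₁ , x₂) (y₁ , y₂) = mat x₁ y₁ x₂ y₂

Independent : V → V → Set
Independent u v = det (columns u v) ≢ zero

_⁻¹ : F5 → F5
zero ⁻¹                         = zero
suc zero ⁻¹                     = one
suc (suc zero) ⁻¹               = suc (suc (suc zero))
suc (suc (suc zero)) ⁻¹         = two
suc (suc (suc (suc zero))) ⁻¹   = suc (suc (suc (suc zero)))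

-- The inverse of columns u v, by the adjugate formula.
changeOfBasis : V → V → Mat
changeOfBasis u@(x₁ , x₂) v@(y₁ , y₂) = mat (δ *₅ y₂) (δ *₅ (zero -₅ y₁)) (δ *₅ (zero -₅ x₂)) (δ *₅ x₁)
  where δ = det (columns u v) ⁻¹

changeOfBasis-correct : ∀ u v → Independent u v →
  changeOfBasis u v ·ₘ columns u v ≡ 1ₘ × columns u v ·ₘ changeOfBasis u v ≡ 1ₘ ×
  apply (changeOfBasis u v) u ≡ e₁ × apply (changeOfBasis u v) v ≡ e₂
changeOfBasis-correct = from-yes (allᵥ? λ u → allᵥ? λ v → ¬? (det (columns u v) ≟ zero) →-dec
  changeOfBasis u v ·ₘ columns u v ≟ₘ 1ₘ ×-dec columns u v ·ₘ changeOfBasis u v ≟ₘ 1ₘ ×-dec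
  apply (changeOfBasis u v) u ≟ᵥ e₁ ×-dec apply (changeOfBasis u v) v ≟ᵥ e₂)

toStandardBasis : ∀ u v → Independent u v → Σ Mat λ φ → Invertible φ × apply φ u ≡ e₁ × apply φ v ≡ e₂
toStandardBasis u v ind =
  let BC≡1 , CB≡1 , Bu≡e₁ , Bv≡e₂ = changeOfBasis-correct u v ind
  in changeOfBasis u v , inverse⇒invertible {changeOfBasis u v} {columns u v} CB≡1 BC≡1 , Bu≡e₁ , Bv≡e₂

SumFreeSet : List V → Set
SumFreeSet A = Unique A × SumFree A

sumFree-⊆ : ∀ {A B} → A ⊆ B → SumFree B → SumFree A
sumFree-⊆ A⊆B sf a∈ b∈ c∈ = sf (A⊆B a∈) (A⊆B b∈) (A⊆B c∈)

sumFree? : ∀ A → Dec (SumFree A)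
sumFree? A = map′ to from (All.all? (λ a → All.all? (λ b → ¬? (a ⊕ b ∈? A)) A) A)
  where
  to : All (λ a → All (λ b → ¬ (a ⊕ b ∈ A)) A) A → SumFree A
  to h a∈ b∈ c∈ refl = All.lookup (All.lookup h a∈) b∈ c∈
  from : SumFree A → All (λ a → All (λ b → ¬ (a ⊕ b ∈ A)) A) A
  from sf = All.tabulate λ a∈ → All.tabulate λ b∈ c∈ → sf a∈ b∈ c∈ refl

sumFreeSet? : ∀ A → Dec (SumFreeSet A)
sumFreeSet? A = unique? _≟ᵥ_ A ×-dec sumFree? A

unique-++⁻ˡ : ∀ (xs : List V) {ys} → Unique (xs ++ ys) → Unique xs
unique-++⁻ˡ []       _          = []
unique-++⁻ˡ (x ∷ xs) (x∉ ∷ xs!) = ++⁻ˡ xs x∉ ∷ unique-++⁻ˡ xs xs!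

sumFreeSet-++⁻ˡ : ∀ xs {ys} → SumFreeSet (xs ++ ys) → SumFreeSet xs
sumFreeSet-++⁻ˡ xs (xs! , sf) = unique-++⁻ˡ xs xs! , sumFree-⊆ (xs⊆xs++ys xs _) sf

swap-⊆ : ∀ {a b c : V} {xs} → a ∷ c ∷ b ∷ xs ⊆ a ∷ b ∷ c ∷ xs
swap-⊆ (here p)                 = here p
swap-⊆ (there (here p))         = there (there (here p))
swap-⊆ (there (there (here p))) = there (here p)
swap-⊆ (there (there (there p))) = there (there (there p))

sumFreeSet-swap : ∀ {a b c xs} → SumFreeSet (a ∷ b ∷ c ∷ xs) → SumFreeSet (a ∷ c ∷ b ∷ xs)
sumFreeSet-swap ((a≢b ∷ a≢c ∷ a∉) ∷ (b≢c ∷ b∉) ∷ c∉ ∷ xs! , sf) =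
  ((a≢c ∷ a≢b ∷ a∉) ∷ (b≢c ∘ sym ∷ c∉) ∷ b∉ ∷ xs!) , sumFree-⊆ swap-⊆ sf

sumFreeSet-map : ∀ {M A} → Invertible M → SumFreeSet A → SumFreeSet (map (apply M) A)
sumFreeSet-map {M} {A} M-inv (A! , sf) = Unique.map⁺ (invertible⇒injective {M} M-inv) A! , sf′
  where
  sf′ : SumFree (map (apply M) A)
  sf′ Ma∈ Mb∈ Mc∈ eq with ∈-map⁻ (apply M) Ma∈ | ∈-map⁻ (apply M) Mb∈ | ∈-map⁻ (apply M) Mc∈
  ... | a , a∈ , refl | b , b∈ , refl | c , c∈ , refl =
    sf a∈ b∈ c∈ (invertible⇒injective {M} M-inv (trans (apply-⊕ M a b) eq))

⊖_ : V → V
⊖ (x , y) = (zero -₅ x , zero -₅ y)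

-- Here b = λ a with a ≠ 0 (as a + a ≠ a), and λ = 1, 2, 3 would give
-- b = a, a + a = b and b + b = a respectively.
dependent⇒negative : ∀ a b → SumFree (a ∷ b ∷ []) → a ≢ b → det (columns a b) ≡ zero → b ≡ ⊖ a
dependent⇒negative = from-yes (allᵥ? λ a → allᵥ? λ b → sumFree? (a ∷ b ∷ []) →-dec ¬? (a ≟ᵥ b) →-dec
  det (columns a b) ≟ zero →-dec b ≟ᵥ ⊖ a)

independent-pair : ∀ {a b c xs} → SumFreeSet (a ∷ b ∷ c ∷ xs) → Independent a b ⊎ Independent a c
independent-pair {a} {b} {c} {xs} ((a≢b ∷ a≢c ∷ _) ∷ (b≢c ∷ _) ∷ _ , sf)
  with det (columns a b) ≟ zero | det (columns a c) ≟ zero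
... | no a,b-independent | _                  = inj₁ a,b-independent
... | yes _              | no a,c-independent = inj₂ a,c-independent
... | yes a,b-dependent  | yes a,c-dependent  = ⊥-elim (b≢c (begin
  b   ≡⟨ dependent⇒negative a b (sumFree-⊆ (xs⊆xs++ys _ (c ∷ xs)) sf) a≢b a,b-dependent ⟩
  ⊖ a ≡⟨ dependent⇒negative a c (sumFree-⊆ (swap-⊆ ∘ xs⊆xs++ys _ (b ∷ xs)) sf) a≢c a,c-dependent ⟨
  c   ∎))

ProgressionAt : List V → V → Set
ProgressionAt A x = Σ V λ y → Independent x y × x ⊕ y ∈ A × (x ⊕ y) ⊕ y ∈ A

Progression : List V → Set
Progression A = Σ V λ x → x ∈ A × ProgressionAt A x

progression? : ∀ A → Dec (Progression A)
progression? A = map′ find (λ (x , x∈ , p) → Any.map (λ { refl → p }) x∈) (Any.any? progressionAt? A)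
  where
  progressionAt? : Decidable (ProgressionAt A)
  progressionAt? x = anyᵥ? λ y → ¬? (det (columns x y) ≟ zero) ×-dec x ⊕ y ∈? A ×-dec (x ⊕ y) ⊕ y ∈? A

StraightenedBy : Mat → List V → Set
StraightenedBy φ A = InImage φ A (one , zero) × InImage φ A (one , one) × InImage φ A (one , two)

Straightenable : List V → Set
Straightenable A = Σ Mat λ φ → Invertible φ × StraightenedBy φ A

straightenable-⊆ : ∀ {A B} → A ⊆ B → Straightenable A → Straightenable B
straightenable-⊆ A⊆B (φ , φ-inv , p , q , r) = φ , φ-inv , widen p , widen q , widen r
  where
  widen : ∀ {w} → InImage φ _ w → InImage φ _ w
  widen (u , u∈ , φu≡w) = u , A⊆B u∈ , φu≡w

straightenable-map⁻ : ∀ {M A} → Invertible M → Straightenable (map (apply M) A) → Straightenable A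
straightenable-map⁻ {M} {A} M-inv (φ , φ-inv , p , q , r) =
  φ ·ₘ M , invertible-·ₘ {φ} {M} φ-inv M-inv , pull p , pull q , pull r
  where
  pull : ∀ {w} → InImage φ (map (apply M) A) w → InImage (φ ·ₘ M) A w
  pull (_ , Mu∈ , φMu≡w) with ∈-map⁻ (apply M) Mu∈
  ... | u , u∈ , refl = u , u∈ , trans (apply-·ₘ φ M u) φMu≡w

progression⇒straightenable : ∀ {A} → Progression A → Straightenable A
progression⇒straightenable (x , x∈ , y , ind , x+y∈ , x+2y∈) =
  let φ , φ-inv , φx≡e₁ , φy≡e₂ = toStandardBasis x y ind
      φ[x+y]≡e₁+e₂ : apply φ (x ⊕ y) ≡ (one , one)
      φ[x+y]≡e₁+e₂ = trans (apply-⊕ φ x y) (cong₂ _⊕_ φx≡e₁ φy≡e₂)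
      φ[x+2y]≡e₁+2e₂ : apply φ ((x ⊕ y) ⊕ y) ≡ (one , two)
      φ[x+2y]≡e₁+2e₂ = trans (apply-⊕ φ (x ⊕ y) y) (cong₂ _⊕_ φ[x+y]≡e₁+e₂ φy≡e₂)
  in φ , φ-inv , (x , x∈ , φx≡e₁) , (x ⊕ y , x+y∈ , φ[x+y]≡e₁+e₂)
              , ((x ⊕ y) ⊕ y , x+2y∈ , φ[x+2y]≡e₁+2e₂)

-- Quantifying in stages lets the decision procedure discard non-sum-free prefixes early.
progression-search : ∀ c → SumFreeSet (e₁ ∷ e₂ ∷ c ∷ []) →
                     ∀ d → SumFreeSet (e₁ ∷ e₂ ∷ c ∷ d ∷ []) →
                     ∀ e → SumFreeSet (e₁ ∷ e₂ ∷ c ∷ d ∷ e ∷ []) → Progression (e₁ ∷ e₂ ∷ c ∷ d ∷ e ∷ [])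
progression-search = from-yes
  (allᵥ? λ c → sumFreeSet? (e₁ ∷ e₂ ∷ c ∷ []) →-dec
   allᵥ? λ d → sumFreeSet? (e₁ ∷ e₂ ∷ c ∷ d ∷ []) →-dec
   allᵥ? λ e → sumFreeSet? (e₁ ∷ e₂ ∷ c ∷ d ∷ e ∷ []) →-dec progression? (e₁ ∷ e₂ ∷ c ∷ d ∷ e ∷ []))

five-progression-at-standard-basis : ∀ {a b c d e} → a ≡ e₁ → b ≡ e₂ →
  SumFreeSet (a ∷ b ∷ c ∷ d ∷ e ∷ []) → Progression (a ∷ b ∷ c ∷ d ∷ e ∷ [])
five-progression-at-standard-basis {c = c} {d} {e} refl refl S = progression-search
  c (sumFreeSet-++⁻ˡ (e₁ ∷ e₂ ∷ c ∷ []) S) d (sumFreeSet-++⁻ˡ (e₁ ∷ e₂ ∷ c ∷ d ∷ []) S) e S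

five-straightenable-from-basis : ∀ {a b c d e} → Independent a b →
  SumFreeSet (a ∷ b ∷ c ∷ d ∷ e ∷ []) → Straightenable (a ∷ b ∷ c ∷ d ∷ e ∷ [])
five-straightenable-from-basis {a} {b} ind S =
  let φ , φ-inv , φa≡e₁ , φb≡e₂ = toStandardBasis a b ind
  in straightenable-map⁻ {φ} φ-inv
       (progression⇒straightenable (five-progression-at-standard-basis φa≡e₁ φb≡e₂ (sumFreeSet-map {φ} φ-inv S)))

five-straightenable : ∀ {a b c d e} →
  SumFreeSet (a ∷ b ∷ c ∷ d ∷ e ∷ []) → Straightenable (a ∷ b ∷ c ∷ d ∷ e ∷ [])
five-straightenable S with independent-pair S
... | inj₁ a,b-independent = five-straightenable-from-basis a,b-independent S
... | inj₂ a,c-independent =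
  straightenable-⊆ swap-⊆ (five-straightenable-from-basis a,c-independent (sumFreeSet-swap S))

lemma3p1 : (A : List V) → Unique A → SumFree A → 5 ≤ length A →
    Σ Mat (λ φ → Invertible φ × InImage φ A (one , zero) × InImage φ A (one , one) × InImage φ A (one , two))
lemma3p1 (a ∷ b ∷ c ∷ d ∷ e ∷ rest) A! sf (s≤s (s≤s (s≤s (s≤s (s≤s _))))) =
  straightenable-⊆ (xs⊆xs++ys five rest) (five-straightenable (sumFreeSet-++⁻ˡ five (A! , sf)))
  where five = a ∷ b ∷ c ∷ d ∷ e ∷ []
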